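{- Fix a $4$-cycle $T$ (a set of four lines $\{a,b\},\{b,c\},\{c,d\},\{d,a\}$ with $a,b,c,d\in P$ distinct). The number of connected proper line complexes on the $8$-point set $P$ that contain $T$, have $T$ as their unique $4$-cycle, and in which all four vertices $a,b,c,d$ of $T$ have valence greater than $2$, is $4!=24$.
   Context: $P$ is a set of $8$ points (the points of $\mathbb F_2^3$). A line is a $2$-element subset of $P$. A line complex is a set of exactly $8$ distinct lines. $\mathcal C$ omits $p$ if no line of $\mathcal C$ contains $p$. Viewing $\mathcal C$ as a graph with vertex set $P$ and edge set $\mathcal C$, an isolated tree is a connected component containing at least one line which is a tree; $\mathcal C$ is connected if this graph is connected. A complex is proper if it omits no point and has no isolated tree. The valence of a point is the number of lines of $\mathcal C$ containing it. A $4$-cycle is a set of $4$ lines $\{p_1,p_2\},\{p_2,p_3\},\{p_3,p_4\},\{p_4,p_1\}$ with $p_i$ distinct. -}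

module Defs where

open import Data.Bool using (Bool; true; false; _∧_; _∨_; if_then_else_)
open import Data.Nat using (ℕ; _≤_; _<_; _+_)
open import Data.Fin using (Fin; _≟_)
import Data.Fin as F
open import Data.Vec using (Vec; lookup; tabulate)
open import Data.List using (List; []; _∷_; _++_; take; length; map; allFin; filter; cartesianProduct)
open import Data.Nat.ListAction using (sum)
open import Data.List.Relation.Unary.Unique.Propositional using (Unique)
open import Data.Product using (Σ; _×_; ∃; _,_; proj₁; proj₂)
open import Data.Unit using (⊤)
open import Relation.Binary.PropositionalEquality using (_≡_; _≢_)
open import Relation.Nullary using (¬_)
open import Relation.Nullary.Decidable using (⌊_⌋)

-- The 8 points of F₂³ (only their number matters; labelled by Fin 8).
Point : Set
Point = Fin 8

-- A family of lines (2-element subsets of P) is encoded by its symmetric,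
-- irreflexive incidence matrix: the line {p,q} belongs to C iff
-- edge C p q ≡ true (equivalently edge C q p ≡ true).
LineSet : Set
LineSet = Vec (Vec Bool 8) 8

edge : LineSet → Point → Point → Bool
edge C p q = lookup (lookup C p) q

HasLine : LineSet → Point → Point → Set
HasLine C p q = edge C p q ≡ true

lines : LineSet → List (Point × Point)
lines C = filter (λ pq → F._<?_ (proj₁ pq) (proj₂ pq))
            (filter (λ pq → Data.Bool._≟_ (edge C (proj₁ pq) (proj₂ pq)) true)
              (cartesianProduct (allFin 8) (allFin 8)))
  where import Data.Bool

IsLineComplex : LineSet → Set
IsLineComplex C = (∀ p q → edge C p q ≡ edge C q p)
                × (∀ p → edge C p p ≡ false)
                × length (lines C) ≡ 8

Omits : LineSet → Point → Set
Omits C p = ∀ q → edge C p q ≡ false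

data Reach (C : LineSet) : Point → Point → Set where
  here : ∀ {p} → Reach C p p
  step : ∀ {p q r} → HasLine C p q → Reach C q r → Reach C p r

Connected : LineSet → Set
Connected C = ∀ p q → Reach C p q

Chain : LineSet → List Point → Set
Chain C [] = ⊤
Chain C (x ∷ []) = ⊤
Chain C (x ∷ y ∷ r) = HasLine C x y × Chain C (y ∷ r)

Cycle : LineSet → List Point → Set
Cycle C vs = 3 ≤ length vs × Unique vs × Chain C (vs ++ take 1 vs)

ComponentHasCycle : LineSet → Point → Set
ComponentHasCycle C p = Σ (List Point) λ vs → Cycle C vs × (∀ v → v ∈ vs → Reach C p v)
  where open import Data.List.Membership.Propositional using (_∈_)

-- an isolated tree: the component of some point p contains a line and is a tree
-- (connected by definition, and acyclic)
HasIsolatedTree : LineSet → Set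
HasIsolatedTree C = Σ Point λ p → (Σ Point λ q → HasLine C p q) × ¬ ComponentHasCycle C p

Proper : LineSet → Set
Proper C = (∀ p → ¬ Omits C p) × ¬ HasIsolatedTree C

valence : LineSet → Point → ℕ
valence C p = sum (map (λ q → if edge C p q then 1 else 0) (allFin 8))

link : Point → Point → Point → Point → Bool
link u v x y = (⌊ x ≟ u ⌋ ∧ ⌊ y ≟ v ⌋) ∨ (⌊ x ≟ v ⌋ ∧ ⌊ y ≟ u ⌋)

fourCycle : Point → Point → Point → Point → LineSet
fourCycle p₁ p₂ p₃ p₄ = tabulate λ x → tabulate λ y →
  link p₁ p₂ x y ∨ link p₂ p₃ x y ∨ link p₃ p₄ x y ∨ link p₄ p₁ x y

Distinct4 : Point → Point → Point → Point → Set
Distinct4 a b c d = a ≢ b × a ≢ c × a ≢ d × b ≢ c × b ≢ d × c ≢ d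

Contains : LineSet → LineSet → Set
Contains C T = ∀ x y → edge T x y ≡ true → edge C x y ≡ true

IsFourCycleIn : LineSet → Point → Point → Point → Point → Set
IsFourCycleIn C p₁ p₂ p₃ p₄ = Distinct4 p₁ p₂ p₃ p₄
  × HasLine C p₁ p₂ × HasLine C p₂ p₃ × HasLine C p₃ p₄ × HasLine C p₄ p₁

UniqueFourCycle : LineSet → LineSet → Set
UniqueFourCycle C T = ∀ p₁ p₂ p₃ p₄ → IsFourCycleIn C p₁ p₂ p₃ p₄ → fourCycle p₁ p₂ p₃ p₄ ≡ T

Good : Point → Point → Point → Point → LineSet → Set
Good a b c d C = IsLineComplex C × Connected C × Proper C
  × Contains C (fourCycle a b c d) × UniqueFourCycle C (fourCycle a b c d)
  × 2 < valence C a × 2 < valence C b × 2 < valence C c × 2 < valence C d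

-- Relabelling the points by a permutation preserves every notion involved, so we may assume
-- that T is the cycle 0-1-2-3. By the handshake lemma the valences of a complex with 8 lines
-- add up to 16; the vertices of T have valence at least 3 and, as no point is omitted, the
-- four other points have valence at least 1, so all these bounds are attained. Two adjacent
-- points of valence 1 would form a component of their own, so each of the points 4 … 7 is
-- joined to exactly one vertex of T, and the complex is determined by these attachments
-- together with the diagonals of T it contains. Among these 4⁴ · 4 candidates, evaluation
-- shows that exactly the 24 with bijective attachments and no diagonal have valence 3 at
-- every vertex of T, and that all 24 of them are good.

module Submission where

open import Defs
open import Data.Nat using (ℕ; zero; suc; _+_; _*_; _≤_; _<_; _!)
import Data.Nat as ℕ
open import Data.Nat.Properties
  using (+-0-commutativeMonoid; ≤-antisym; m≤m+n; +-monoʳ-≤; +-mono-≤; +-cancelʳ-≤; +-cancelˡ-≡; *-cancelˡ-≡; +-identityʳ; module ≤-Reasoning)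
open import Data.Nat.ListAction.Properties using (sum-++)
import Data.Nat.ListAction as List
open import Data.Bool using (Bool; true; false; _∨_; if_then_else_)
import Data.Bool as Bool
open import Data.Bool.Properties using (¬-not; ∨-zeroʳ)
open import Data.Fin using (Fin; zero; suc; punchIn; punchOut; _↑ˡ_; _↑ʳ_)
open import Data.Fin.Patterns
open import Data.Fin.Properties
  using (_≟_; _<?_; <-cmp; any?; all?; ¬∀⟶∃¬; punchIn-punchOut; punchOut-injective; ↑ˡ-injective)
open import Data.Fin.Permutation using (Permutation′; _⟨$⟩ʳ_; _⟨$⟩ˡ_; inverseˡ; inverseʳ; insert; id; flip)
open import Data.Vec using (Vec; []; _∷_; lookup; tabulate)
open import Data.Vec.Properties using (lookup∘tabulate; tabulate∘lookup; tabulate-cong; ≡-dec)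
open import Data.Vec.Functional using (removeAt)
open import Data.List using (List; []; _∷_; [_]; _++_; length; map; filter; allFin; cartesianProduct; cartesianProductWith)
open import Data.List.Properties using (map-++; map-∘; length-map)
open import Data.List.Membership.Propositional using (_∈_)
open import Data.List.Membership.Propositional.Properties
  using (∈-allFin; ∈-map⁺; ∈-map⁻; ∈-filter⁺; ∈-cartesianProductWith⁺; ∈-cartesianProduct⁺)
open import Data.List.Relation.Unary.Any using (here; there)
open import Data.List.Relation.Unary.All using (All; []; _∷_)
import Data.List.Relation.Unary.All as All
open import Data.List.Relation.Unary.AllPairs using ([]; _∷_)
open import Data.List.Relation.Unary.Unique.Propositional using (Unique)
import Data.List.Relation.Unary.Unique.Propositional.Properties as Unique
open import Data.List.Relation.Unary.Unique.DecPropositional using (unique?)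
open import Data.Product using (Σ; ∃; _×_; _,_; proj₁; proj₂; map₂)
open import Data.Sum using (_⊎_; inj₁; inj₂)
open import Function using (_∘_)
open import Relation.Nullary using (¬_; Dec; does; yes; no; ¬?; contradiction)
open import Relation.Nullary.Decidable
  using (⌊_⌋; dec-true; dec-false; _×-dec_; _⊎-dec_; _→-dec_; from-yes; map′)
open import Relation.Unary using (Pred; Decidable)
open import Relation.Binary.Definitions using (tri<; tri≈; tri>)
open import Relation.Binary.PropositionalEquality hiding ([_])
open import Algebra.Properties.CommutativeMonoid.Sum +-0-commutativeMonoid
  using (sum; sum-remove; ∑-comm; ∑-distrib-+; ∑-permute; sum-cong-≗)

term≤sum : ∀ {n} (f : Fin n → ℕ) i → f i ≤ sum f
term≤sum {suc n} f i = subst (f i ≤_) (sym (sum-remove f)) (m≤m+n (f i) _)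

two-terms≤sum : ∀ {n} (f : Fin n → ℕ) {i j} → i ≢ j → f i + f j ≤ sum f
two-terms≤sum {suc n} f {i} {j} i≢j = begin
  f i + f j                         ≡⟨ cong (λ k → f i + f k) (punchIn-punchOut i≢j) ⟨
  f i + removeAt f i (punchOut i≢j) ≤⟨ +-monoʳ-≤ (f i) (term≤sum (removeAt f i) (punchOut i≢j)) ⟩
  f i + sum (removeAt f i)          ≡⟨ sum-remove f ⟨
  sum f                             ∎
  where open ≤-Reasoning

sum-mono-≤ : ∀ {n} {f g : Fin n → ℕ} → (∀ i → g i ≤ f i) → sum g ≤ sum f
sum-mono-≤ {zero}  g≤f = ℕ.z≤n
sum-mono-≤ {suc n} g≤f = +-mono-≤ (g≤f zero) (sum-mono-≤ (g≤f ∘ suc))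

+-tight : ∀ {a b A B} → b ≤ a → B ≤ A → a + A ≡ b + B → a ≡ b × A ≡ B
+-tight {a} {b} {A} {B} b≤a B≤A eq = a≡b , +-cancelˡ-≡ a A B (trans eq (cong (_+ B) (sym a≡b)))
  where
  a≡b : a ≡ b
  a≡b = ≤-antisym (+-cancelʳ-≤ A a b (subst (_≤ b + A) (sym eq) (+-monoʳ-≤ b B≤A))) b≤a

sum-tight : ∀ {n} {f g : Fin n → ℕ} → (∀ i → g i ≤ f i) → sum f ≡ sum g → ∀ i → f i ≡ g i
sum-tight {suc n} g≤f eq zero    = proj₁ (+-tight (g≤f zero) (sum-mono-≤ (g≤f ∘ suc)) eq)
sum-tight {suc n} g≤f eq (suc i) = sum-tight (g≤f ∘ suc) (proj₂ (+-tight (g≤f zero) (sum-mono-≤ (g≤f ∘ suc)) eq)) i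

length-filter-filter : ∀ {A : Set} {ℓ} {P Q : Pred A ℓ} (P? : Decidable P) (Q? : Decidable Q) xs →
  length (filter P? (filter Q? xs)) ≡ List.sum (map (λ x → if does (Q? x) then (if does (P? x) then 1 else 0) else 0) xs)
length-filter-filter P? Q? []       = refl
length-filter-filter P? Q? (x ∷ xs) with does (Q? x)
... | false = length-filter-filter P? Q? xs
... | true with does (P? x)
...   | false = length-filter-filter P? Q? xs
...   | true  = cong suc (length-filter-filter P? Q? xs)

sum-cartesianProduct : ∀ {A B : Set} (g : A × B → ℕ) xs ys →
  List.sum (map g (cartesianProduct xs ys)) ≡ List.sum (map (λ x → List.sum (map (λ y → g (x , y)) ys)) xs)
sum-cartesianProduct g []       ys = refl
sum-cartesianProduct g (x ∷ xs) ys = begin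
  List.sum (map g (map (x ,_) ys ++ cartesianProduct xs ys))
    ≡⟨ cong List.sum (map-++ g (map (x ,_) ys) (cartesianProduct xs ys)) ⟩
  List.sum (map g (map (x ,_) ys) ++ map g (cartesianProduct xs ys))
    ≡⟨ sum-++ (map g (map (x ,_) ys)) _ ⟩
  List.sum (map g (map (x ,_) ys)) + List.sum (map g (cartesianProduct xs ys))
    ≡⟨ cong₂ _+_ (cong List.sum (sym (map-∘ ys))) (sum-cartesianProduct g xs ys) ⟩
  List.sum (map (λ y → g (x , y)) ys) + List.sum (map (λ x → List.sum (map (λ y → g (x , y)) ys)) xs) ∎
  where open ≡-Reasoning

Symmetric : LineSet → Set
Symmetric C = ∀ p q → edge C p q ≡ edge C q p

Irreflexive : LineSet → Set
Irreflexive C = ∀ p → edge C p p ≡ false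

incidence : LineSet → Point → Point → ℕ
incidence C p q = if edge C p q then 1 else 0

upperIncidence : LineSet → Point → Point → ℕ
upperIncidence C p q = if does (edge C p q Bool.≟ true) then (if does (p <? q) then 1 else 0) else 0

length-lines : ∀ C → length (lines C) ≡ sum λ p → sum λ q → upperIncidence C p q
length-lines C = trans
  (length-filter-filter (λ pq → proj₁ pq <? proj₂ pq) (λ pq → edge C (proj₁ pq) (proj₂ pq) Bool.≟ true) _)
  (sum-cartesianProduct (λ pq → upperIncidence C (proj₁ pq) (proj₂ pq)) (allFin 8) (allFin 8))

incidence-split : ∀ C → Symmetric C → Irreflexive C → ∀ p q →
  incidence C p q ≡ upperIncidence C p q + upperIncidence C q p
incidence-split C isSym isIrr p q rewrite isSym q p with edge C p q in e
... | false = refl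
... | true with <-cmp p q
...   | tri< p<q _ q≮p rewrite dec-true (p <? q) p<q | dec-false (q <? p) q≮p = refl
...   | tri> p≮q _ q<p rewrite dec-false (p <? q) p≮q | dec-true (q <? p) q<p = refl
...   | tri≈ _ refl _ = contradiction (trans (sym e) (isIrr p)) λ ()

handshake : ∀ C → Symmetric C → Irreflexive C → sum (valence C) ≡ 2 * length (lines C)
handshake C isSym isIrr = begin
  sum (λ p → sum (incidence C p))
    ≡⟨ sum-cong (λ p → sum-cong (incidence-split C isSym isIrr p)) ⟩
  sum (λ p → sum (λ q → upper p q + upper q p))
    ≡⟨ sum-cong (λ p → ∑-distrib-+ (upper p) (λ q → upper q p)) ⟩
  sum (λ p → sum (upper p) + sum (λ q → upper q p))
    ≡⟨ ∑-distrib-+ (λ p → sum (upper p)) (λ p → sum (λ q → upper q p)) ⟩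
  sum (λ p → sum (upper p)) + sum (λ p → sum (λ q → upper q p))
    ≡⟨ cong (sum (λ p → sum (upper p)) +_) (∑-comm (λ q p → upper q p)) ⟨
  sum (λ p → sum (upper p)) + sum (λ p → sum (upper p))
    ≡⟨ cong₂ _+_ (length-lines C) (trans (+-identityʳ _) (length-lines C)) ⟨
  2 * length (lines C) ∎
  where
  open ≡-Reasoning
  upper = upperIncidence C
  sum-cong = sum-cong-≗

incidence-line : ∀ C {p q} → HasLine C p q → incidence C p q ≡ 1
incidence-line C e = cong (if_then 1 else 0) e

line⇒valence-positive : ∀ C {p q} → HasLine C p q → 1 ≤ valence C p
line⇒valence-positive C {p} {q} e = subst (_≤ valence C p) (incidence-line C e) (term≤sum (incidence C p) q)

¬omits⇒line : ∀ C {p} → ¬ Omits C p → ∃ (HasLine C p)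
¬omits⇒line C {p} ¬omits = map₂ ¬-not (¬∀⟶∃¬ 8 _ (λ q → edge C p q Bool.≟ false) ¬omits)

valence-one⇒unique-line : ∀ C {p q r} → valence C p ≡ 1 → HasLine C p q → HasLine C p r → q ≡ r
valence-one⇒unique-line C {p} {q} {r} v≡1 pq pr with q ≟ r
... | yes q≡r = q≡r
... | no  q≢r = contradiction
  (subst₂ _≤_ (cong₂ _+_ (incidence-line C pq) (incidence-line C pr)) v≡1 (two-terms≤sum (incidence C p) q≢r))
  λ { (ℕ.s≤s ()) }

pendant-line-component : ∀ C {p q} → Symmetric C → valence C p ≡ 1 → valence C q ≡ 1 → HasLine C p q →
  ∀ {u t} → u ≡ p ⊎ u ≡ q → Reach C u t → t ≡ p ⊎ t ≡ q
pendant-line-component C isSym vp vq pq u∈ here = u∈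
pendant-line-component C isSym vp vq pq (inj₁ refl) (step ps reach) =
  pendant-line-component C isSym vp vq pq (inj₂ (valence-one⇒unique-line C vp ps pq)) reach
pendant-line-component C {p} {q} isSym vp vq pq (inj₂ refl) (step qs reach) =
  pendant-line-component C isSym vp vq pq (inj₁ (valence-one⇒unique-line C vq qs (trans (isSym q p) pq))) reach

edge-tabulate : ∀ (e : Point → Point → Bool) x y → edge (tabulate λ x → tabulate (e x)) x y ≡ e x y
edge-tabulate e x y = trans (cong (λ row → lookup row y) (lookup∘tabulate (tabulate ∘ e) x)) (lookup∘tabulate (e x) y)

tabulate-edge : ∀ C → tabulate (λ x → tabulate (edge C x)) ≡ C
tabulate-edge C = trans (tabulate-cong λ x → tabulate∘lookup (lookup C x)) (tabulate∘lookup C)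

lineSet-ext : ∀ {C D} → (∀ x y → edge C x y ≡ edge D x y) → C ≡ D
lineSet-ext {C} {D} eq =
  trans (sym (tabulate-edge C)) (trans (tabulate-cong λ x → tabulate-cong (eq x)) (tabulate-edge D))

edge-fourCycle : ∀ a b c d x y →
  edge (fourCycle a b c d) x y ≡ (link a b x y ∨ link b c x y ∨ link c d x y ∨ link d a x y)
edge-fourCycle a b c d = edge-tabulate λ x y → link a b x y ∨ link b c x y ∨ link c d x y ∨ link d a x y

∨-introˡ : ∀ {x} y → x ≡ true → x ∨ y ≡ true
∨-introˡ y refl = refl

∨-introʳ : ∀ x {y} → y ≡ true → x ∨ y ≡ true
∨-introʳ x refl = ∨-zeroʳ x

link-self : ∀ u v → link u v u v ≡ true
link-self u v with u ≟ u | v ≟ v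
... | yes _ | yes _ = refl
... | no u≢u | _     = contradiction refl u≢u
... | _     | no v≢v = contradiction refl v≢v

fourCycle-cycle : ∀ C {a b c d} → Distinct4 a b c d → Contains C (fourCycle a b c d) → Cycle C (a ∷ b ∷ c ∷ d ∷ [])
fourCycle-cycle C {a} {b} {c} {d} (a≢b , a≢c , a≢d , b≢c , b≢d , c≢d) contains =
  ℕ.s≤s (ℕ.s≤s (ℕ.s≤s ℕ.z≤n)) ,
  (a≢b ∷ a≢c ∷ a≢d ∷ []) ∷ (b≢c ∷ b≢d ∷ []) ∷ (c≢d ∷ []) ∷ [] ∷ [] ,
  line ab , line bc , line cd , line da , _
  where
  line : ∀ {x y} → edge (fourCycle a b c d) x y ≡ true → HasLine C x y
  line = contains _ _
  ab : edge (fourCycle a b c d) a b ≡ true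
  ab = trans (edge-fourCycle a b c d a b) (∨-introˡ _ (link-self a b))
  bc : edge (fourCycle a b c d) b c ≡ true
  bc = trans (edge-fourCycle a b c d b c) (∨-introʳ (link a b b c) (∨-introˡ _ (link-self b c)))
  cd : edge (fourCycle a b c d) c d ≡ true
  cd = trans (edge-fourCycle a b c d c d)
    (∨-introʳ (link a b c d) (∨-introʳ (link b c c d) (∨-introˡ _ (link-self c d))))
  da : edge (fourCycle a b c d) d a ≡ true
  da = trans (edge-fourCycle a b c d d a)
    (∨-introʳ (link a b d a) (∨-introʳ (link b c d a) (∨-introʳ (link c d d a) (link-self d a))))

connected-cycle⇒¬isolatedTree : ∀ {C vs} → Connected C → Cycle C vs → ¬ HasIsolatedTree C
connected-cycle⇒¬isolatedTree {vs = vs} conn cycle (p , _ , ¬cycle) = ¬cycle (vs , cycle , λ v _ → conn p v)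

-- Relabelling

relabel : (Point → Point) → LineSet → LineSet
relabel f C = tabulate λ x → tabulate λ y → edge C (f x) (f y)

edge-relabel : ∀ f C x y → edge (relabel f C) x y ≡ edge C (f x) (f y)
edge-relabel f C = edge-tabulate λ x y → edge C (f x) (f y)

module Relabelling (π : Permutation′ 8) where

  σ σ⁻¹ : Point → Point
  σ = π ⟨$⟩ʳ_
  σ⁻¹ = π ⟨$⟩ˡ_

  relabel-inverse : ∀ C → relabel σ (relabel σ⁻¹ C) ≡ C
  relabel-inverse C = lineSet-ext λ x y → begin
    edge (relabel σ (relabel σ⁻¹ C)) x y ≡⟨ edge-relabel σ (relabel σ⁻¹ C) x y ⟩
    edge (relabel σ⁻¹ C) (σ x) (σ y)     ≡⟨ edge-relabel σ⁻¹ C (σ x) (σ y) ⟩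
    edge C (σ⁻¹ (σ x)) (σ⁻¹ (σ y))       ≡⟨ cong₂ (edge C) (inverseˡ π) (inverseˡ π) ⟩
    edge C x y                           ∎
    where open ≡-Reasoning

  σ-injective : ∀ {x y} → σ x ≡ σ y → x ≡ y
  σ-injective {x} {y} eq = trans (sym (inverseˡ π)) (trans (cong σ⁻¹ eq) (inverseˡ π))

  ≟-σ : ∀ x y → ⌊ σ x ≟ σ y ⌋ ≡ ⌊ x ≟ y ⌋
  ≟-σ x y with x ≟ y | σ x ≟ σ y
  ... | yes _   | yes _     = refl
  ... | yes x≡y | no σx≢σy  = contradiction (cong σ x≡y) σx≢σy
  ... | no x≢y  | yes σx≡σy = contradiction (σ-injective σx≡σy) x≢y
  ... | no _    | no _      = refl

  link-σ : ∀ u v x y → link (σ u) (σ v) (σ x) (σ y) ≡ link u v x y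
  link-σ u v x y rewrite ≟-σ x u | ≟-σ y v | ≟-σ x v | ≟-σ y u = refl

  fourCycle-σ : ∀ a b c d x y → edge (fourCycle (σ a) (σ b) (σ c) (σ d)) (σ x) (σ y) ≡ edge (fourCycle a b c d) x y
  fourCycle-σ a b c d x y rewrite edge-fourCycle (σ a) (σ b) (σ c) (σ d) (σ x) (σ y) | edge-fourCycle a b c d x y
    | link-σ a b x y | link-σ b c x y | link-σ c d x y | link-σ d a x y = refl

  module _ (C : LineSet) where

    C′ : LineSet
    C′ = relabel σ C

    line-σ⁻¹ : ∀ {p q} → HasLine C p q → HasLine C′ (σ⁻¹ p) (σ⁻¹ q)
    line-σ⁻¹ {p} {q} pq = trans (edge-relabel σ C (σ⁻¹ p) (σ⁻¹ q)) (subst₂ (HasLine C) (sym (inverseʳ π)) (sym (inverseʳ π)) pq)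

    line-σ : ∀ {p q} → HasLine C′ p q → HasLine C (σ p) (σ q)
    line-σ {p} {q} pq = trans (sym (edge-relabel σ C p q)) pq

    valence-σ : ∀ p → valence C′ p ≡ valence C (σ p)
    valence-σ p = trans (sum-cong-≗ λ q → cong (if_then 1 else 0) (edge-relabel σ C p q)) (sym (∑-permute (incidence C (σ p)) π))

    symmetric-σ : Symmetric C → Symmetric C′
    symmetric-σ isSym x y = trans (edge-relabel σ C x y) (trans (isSym (σ x) (σ y)) (sym (edge-relabel σ C y x)))

    irreflexive-σ : Irreflexive C → Irreflexive C′
    irreflexive-σ isIrr x = trans (edge-relabel σ C x x) (isIrr (σ x))

    length-σ : Symmetric C → Irreflexive C → length (lines C′) ≡ length (lines C)
    length-σ isSym isIrr = *-cancelˡ-≡ _ _ 2 (begin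
      2 * length (lines C′) ≡⟨ handshake C′ (symmetric-σ isSym) (irreflexive-σ isIrr) ⟨
      sum (valence C′)      ≡⟨ sum-cong-≗ valence-σ ⟩
      sum (valence C ∘ σ)   ≡⟨ ∑-permute (valence C) π ⟨
      sum (valence C)       ≡⟨ handshake C isSym isIrr ⟩
      2 * length (lines C)  ∎)
      where open ≡-Reasoning

    reach-σ⁻¹ : ∀ {u v} → Reach C u v → Reach C′ (σ⁻¹ u) (σ⁻¹ v)
    reach-σ⁻¹ here           = here
    reach-σ⁻¹ (step uw reach) = step (line-σ⁻¹ uw) (reach-σ⁻¹ reach)

    connected-σ : Connected C → Connected C′
    connected-σ conn x y = subst₂ (Reach C′) (inverseˡ π) (inverseˡ π) (reach-σ⁻¹ (conn (σ x) (σ y)))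

    ¬omits-σ : ∀ {p} → ¬ Omits C (σ p) → ¬ Omits C′ p
    ¬omits-σ {p} ¬omits omits = ¬omits λ q →
      trans (cong (edge C (σ p)) (sym (inverseʳ π))) (trans (sym (edge-relabel σ C p (σ⁻¹ q))) (omits (σ⁻¹ q)))

    contains-σ : ∀ {a b c d} → Contains C (fourCycle (σ a) (σ b) (σ c) (σ d)) → Contains C′ (fourCycle a b c d)
    contains-σ {a} {b} {c} {d} contains x y xy =
      trans (edge-relabel σ C x y) (contains (σ x) (σ y) (trans (fourCycle-σ a b c d x y) xy))

    distinct-σ : ∀ {a b c d} → Distinct4 a b c d → Distinct4 (σ a) (σ b) (σ c) (σ d)
    distinct-σ (a≢b , a≢c , a≢d , b≢c , b≢d , c≢d) =
      a≢b ∘ σ-injective , a≢c ∘ σ-injective , a≢d ∘ σ-injective , b≢c ∘ σ-injective , b≢d ∘ σ-injective , c≢d ∘ σ-injective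

    uniqueFourCycle-σ : ∀ {a b c d} → UniqueFourCycle C (fourCycle (σ a) (σ b) (σ c) (σ d)) → UniqueFourCycle C′ (fourCycle a b c d)
    uniqueFourCycle-σ {a} {b} {c} {d} unique p₁ p₂ p₃ p₄ (distinct , l₁ , l₂ , l₃ , l₄) = lineSet-ext λ x y → begin
      edge (fourCycle p₁ p₂ p₃ p₄) x y                         ≡⟨ fourCycle-σ p₁ p₂ p₃ p₄ x y ⟨
      edge (fourCycle (σ p₁) (σ p₂) (σ p₃) (σ p₄)) (σ x) (σ y) ≡⟨ cong (λ T → edge T (σ x) (σ y)) σ-cycle-is-T ⟩
      edge (fourCycle (σ a) (σ b) (σ c) (σ d)) (σ x) (σ y)     ≡⟨ fourCycle-σ a b c d x y ⟩
      edge (fourCycle a b c d) x y                             ∎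
      where
      open ≡-Reasoning
      σ-cycle-is-T = unique (σ p₁) (σ p₂) (σ p₃) (σ p₄) (distinct-σ distinct , line-σ l₁ , line-σ l₂ , line-σ l₃ , line-σ l₄)

    Good-relabel : ∀ {a b c d} → Distinct4 a b c d → Good (σ a) (σ b) (σ c) (σ d) C → Good a b c d C′
    Good-relabel distinct ((isSym , isIrr , len) , conn , (¬omits , _) , contains , unique , va , vb , vc , vd) =
      (symmetric-σ isSym , irreflexive-σ isIrr , trans (length-σ isSym isIrr) len) ,
      connected-σ conn ,
      (¬omits-σ ∘ ¬omits ∘ σ , connected-cycle⇒¬isolatedTree (connected-σ conn) (fourCycle-cycle C′ distinct (contains-σ contains))) ,
      contains-σ contains , uniqueFourCycle-σ unique ,
      valence≥ va , valence≥ vb , valence≥ vc , valence≥ vd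
      where
      valence≥ : ∀ {p} → 2 < valence C (σ p) → 2 < valence C′ p
      valence≥ {p} = subst (2 <_) (sym (valence-σ p))

-- insert 0F x ρ sends 0F to x and suc k to punchIn x (ρ ⟨$⟩ʳ k), so the remaining targets
-- are punched out one after the other.
extend-distinct4 : ∀ {a b c d} → Distinct4 a b c d →
  Σ (Permutation′ 8) λ π → π ⟨$⟩ʳ 0F ≡ a × π ⟨$⟩ʳ 1F ≡ b × π ⟨$⟩ʳ 2F ≡ c × π ⟨$⟩ʳ 3F ≡ d
extend-distinct4 {a} {b} {c} {d} (a≢b , a≢c , a≢d , b≢c , b≢d , c≢d) =
  π , refl , punchIn-punchOut a≢b ,
  trans (cong (punchIn a) (punchIn-punchOut b₁≢c₁)) (punchIn-punchOut a≢c) ,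
  trans (cong (punchIn a) (trans (cong (punchIn b₁) (punchIn-punchOut c₂≢d₂)) (punchIn-punchOut b₁≢d₁))) (punchIn-punchOut a≢d)
  where
  b₁ = punchOut a≢b
  c₁ = punchOut a≢c
  d₁ = punchOut a≢d
  b₁≢c₁ : b₁ ≢ c₁
  b₁≢c₁ = b≢c ∘ punchOut-injective a≢b a≢c
  b₁≢d₁ : b₁ ≢ d₁
  b₁≢d₁ = b≢d ∘ punchOut-injective a≢b a≢d
  c₁≢d₁ : c₁ ≢ d₁
  c₁≢d₁ = c≢d ∘ punchOut-injective a≢c a≢d
  c₂ = punchOut b₁≢c₁
  d₂ = punchOut b₁≢d₁
  c₂≢d₂ : c₂ ≢ d₂
  c₂≢d₂ = c₁≢d₁ ∘ punchOut-injective b₁≢c₁ b₁≢d₁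
  π : Permutation′ 8
  π = insert 0F a (insert 0F b₁ (insert 0F c₂ (insert 0F (punchOut c₂≢d₂) id)))

-- The candidate complexes through the cycle 0-1-2-3

data Kind : Point → Set where
  core : (i : Fin 4) → Kind (i ↑ˡ 4)
  leaf : (j : Fin 4) → Kind (4 ↑ʳ j)

kind : (x : Point) → Kind x
kind 0F = core 0F
kind 1F = core 1F
kind 2F = core 2F
kind 3F = core 3F
kind 4F = leaf 0F
kind 5F = leaf 1F
kind 6F = leaf 2F
kind 7F = leaf 3F

record Shape : Set where
  constructor shape
  field
    attach : Vec (Fin 4) 4
    chords : Bool × Bool

coreEdge : Bool → Bool → Fin 4 → Fin 4 → Bool
coreEdge d₀₂ d₁₃ i j = lookup (lookup rows i) j
  where
  rows : Vec (Vec Bool 4) 4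
  rows = (false ∷ true  ∷ d₀₂   ∷ true  ∷ []) ∷
         (true  ∷ false ∷ true  ∷ d₁₃   ∷ []) ∷
         (d₀₂   ∷ true  ∷ false ∷ true  ∷ []) ∷
         (true  ∷ d₁₃   ∷ true  ∷ false ∷ []) ∷ []

kindEdge : ∀ {x y} → Shape → Kind x → Kind y → Bool
kindEdge (shape _ (d₀₂ , d₁₃)) (core i) (core j) = coreEdge d₀₂ d₁₃ i j
kindEdge (shape attach _) (core i) (leaf j) = does (lookup attach j ≟ i)
kindEdge (shape attach _) (leaf j) (core i) = does (lookup attach j ≟ i)
kindEdge _                  (leaf _) (leaf _) = false

shapeComplex : Shape → LineSet
shapeComplex s = tabulate λ x → tabulate λ y → kindEdge s (kind x) (kind y)

vectors : ∀ {A : Set} → List A → (n : ℕ) → List (Vec A n)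
vectors xs zero    = [ [] ]
vectors xs (suc n) = cartesianProductWith _∷_ xs (vectors xs n)

∈-vectors : ∀ {A : Set} {xs : List A} → (∀ x → x ∈ xs) → ∀ {n} (v : Vec A n) → v ∈ vectors xs n
∈-vectors all∈ []       = here refl
∈-vectors all∈ (x ∷ v) = ∈-cartesianProductWith⁺ _∷_ (all∈ x) (∈-vectors all∈ v)

booleans : List Bool
booleans = true ∷ false ∷ []

∈-booleans : ∀ b → b ∈ booleans
∈-booleans true  = here refl
∈-booleans false = there (here refl)

shapes : List Shape
shapes = cartesianProductWith shape (vectors (allFin 4) 4) (cartesianProduct booleans booleans)

∈-shapes : ∀ s → s ∈ shapes
∈-shapes (shape v (d₀₂ , d₁₃)) = ∈-cartesianProductWith⁺ shape
  (∈-vectors ∈-allFin v) (∈-cartesianProduct⁺ (∈-booleans d₀₂) (∈-booleans d₁₃))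

CoreValencesThree : LineSet → Set
CoreValencesThree C = (i : Fin 4) → valence C (i ↑ˡ 4) ≡ 3

coreValencesThree? : ∀ C → Dec (CoreValencesThree C)
coreValencesThree? C = all? λ i → valence C (i ↑ˡ 4) ℕ.≟ 3

standardComplexes : List LineSet
standardComplexes = filter coreValencesThree? (map shapeComplex shapes)

-- Deciding that the candidates are good

T₀ : LineSet
T₀ = fourCycle 0F 1F 2F 3F

ReachWithin : ℕ → LineSet → Point → Point → Set
ReachWithin zero    C p q = p ≡ q
ReachWithin (suc n) C p q = p ≡ q ⊎ ∃ λ r → HasLine C p r × ReachWithin n C r q

ReachWithin⇒Reach : ∀ n {C p q} → ReachWithin n C p q → Reach C p q
ReachWithin⇒Reach zero    refl                 = here
ReachWithin⇒Reach (suc n) (inj₁ refl)          = here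
ReachWithin⇒Reach (suc n) (inj₂ (r , pr , rq)) = step pr (ReachWithin⇒Reach n rq)

hasLine? : ∀ C p q → Dec (HasLine C p q)
hasLine? C p q = edge C p q Bool.≟ true

reachWithin? : ∀ n C p q → Dec (ReachWithin n C p q)
reachWithin? zero    C p q = p ≟ q
reachWithin? (suc n) C p q = p ≟ q ⊎-dec any? λ r → hasLine? C p r ×-dec reachWithin? n C r q

distinct4? : ∀ a b c d → Dec (Distinct4 a b c d)
distinct4? a b c d = ¬? (a ≟ b) ×-dec ¬? (a ≟ c) ×-dec ¬? (a ≟ d) ×-dec ¬? (b ≟ c) ×-dec ¬? (b ≟ d) ×-dec ¬? (c ≟ d)

_≟ᴸ_ : (C D : LineSet) → Dec (C ≡ D)
_≟ᴸ_ = ≡-dec (≡-dec Bool._≟_)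

isLineComplex? : ∀ C → Dec (IsLineComplex C)
isLineComplex? C = (all? λ p → all? λ q → edge C p q Bool.≟ edge C q p)
  ×-dec (all? λ p → edge C p p Bool.≟ false) ×-dec (length (lines C) ℕ.≟ 8)

¬omits? : ∀ C p → Dec (¬ Omits C p)
¬omits? C p = ¬? (all? λ q → edge C p q Bool.≟ false)

contains? : ∀ C T → Dec (Contains C T)
contains? C T = all? λ x → all? λ y → (edge T x y Bool.≟ true) →-dec (edge C x y Bool.≟ true)

-- The quantifiers of UniqueFourCycle are interleaved with its edge conditions so that
-- evaluation prunes early.
uniqueFourCycle? : ∀ C T → Dec (UniqueFourCycle C T)
uniqueFourCycle? C T = map′
  (λ h a b c d (distinct , ab , bc , cd , da) → h a b ab c bc d cd da distinct)
  (λ h a b ab c bc d cd da distinct → h a b c d (distinct , ab , bc , cd , da))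
  (all? λ a → all? λ b → hasLine? C a b →-dec all? λ c → hasLine? C b c →-dec all? λ d →
    hasLine? C c d →-dec hasLine? C d a →-dec distinct4? a b c d →-dec (fourCycle a b c d ≟ᴸ T))

Checkable : LineSet → Set
Checkable C = IsLineComplex C × (∀ p q → ReachWithin 4 C p q) × (∀ p → ¬ Omits C p)
  × Contains C T₀ × UniqueFourCycle C T₀
  × 2 < valence C 0F × 2 < valence C 1F × 2 < valence C 2F × 2 < valence C 3F

checkable? : ∀ C → Dec (Checkable C)
checkable? C = isLineComplex? C ×-dec (all? λ p → all? λ q → reachWithin? 4 C p q) ×-dec all? (¬omits? C)
  ×-dec contains? C T₀ ×-dec uniqueFourCycle? C T₀
  ×-dec 2 ℕ.<? valence C 0F ×-dec 2 ℕ.<? valence C 1F ×-dec 2 ℕ.<? valence C 2F ×-dec 2 ℕ.<? valence C 3F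

distinct0123 : Distinct4 0F 1F 2F 3F
distinct0123 = (λ ()) , (λ ()) , (λ ()) , (λ ()) , (λ ()) , (λ ())

Checkable⇒Good : ∀ {C} → Checkable C → Good 0F 1F 2F 3F C
Checkable⇒Good {C} (lc , reach , ¬omits , contains , unique , v₀ , v₁ , v₂ , v₃) =
  lc , conn , (¬omits , connected-cycle⇒¬isolatedTree conn (fourCycle-cycle C distinct0123 contains)) ,
  contains , unique , v₀ , v₁ , v₂ , v₃
  where
  conn : Connected C
  conn p q = ReachWithin⇒Reach 4 (reach p q)

standardComplexes-good : All (Good 0F 1F 2F 3F) standardComplexes
standardComplexes-good = All.map Checkable⇒Good (from-yes (All.all? checkable? standardComplexes))

standardComplexes-unique : Unique standardComplexes
standardComplexes-unique = from-yes (unique? _≟ᴸ_ standardComplexes)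

standardComplexes-length : length standardComplexes ≡ 24
standardComplexes-length = refl

-- Every good complex through 0-1-2-3 is a candidate

module Classification (C : LineSet) (isSym : Symmetric C) (isIrr : Irreflexive C) (len : length (lines C) ≡ 8)
  (conn : Connected C) (¬omits : ∀ p → ¬ Omits C p) (contains : Contains C T₀)
  (v₀ : 2 < valence C 0F) (v₁ : 2 < valence C 1F) (v₂ : 2 < valence C 2F) (v₃ : 2 < valence C 3F) where

  valenceBound : ∀ {x} → Kind x → ℕ
  valenceBound (core _) = 3
  valenceBound (leaf _) = 1

  valence≥bound : ∀ {x} (k : Kind x) → valenceBound k ≤ valence C x
  valence≥bound (core 0F) = v₀
  valence≥bound (core 1F) = v₁
  valence≥bound (core 2F) = v₂
  valence≥bound (core 3F) = v₃
  valence≥bound (leaf j)  = line⇒valence-positive C (proj₂ (¬omits⇒line C (¬omits (4 ↑ʳ j))))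

  valence≡bound : ∀ x → valence C x ≡ valenceBound (kind x)
  valence≡bound = sum-tight (λ x → valence≥bound (kind x)) (trans (handshake C isSym isIrr) (cong (2 ℕ.*_) len))

  core-valence : CoreValencesThree C
  core-valence 0F = valence≡bound 0F
  core-valence 1F = valence≡bound 1F
  core-valence 2F = valence≡bound 2F
  core-valence 3F = valence≡bound 3F

  leaf-valence : ∀ j → valence C (4 ↑ʳ j) ≡ 1
  leaf-valence 0F = valence≡bound 4F
  leaf-valence 1F = valence≡bound 5F
  leaf-valence 2F = valence≡bound 6F
  leaf-valence 3F = valence≡bound 7F

  leaves-nonadjacent : ∀ j k → edge C (4 ↑ʳ j) (4 ↑ʳ k) ≡ false
  leaves-nonadjacent j k with edge C (4 ↑ʳ j) (4 ↑ʳ k) in jk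
  ... | false = refl
  ... | true with pendant-line-component C isSym (leaf-valence j) (leaf-valence k) jk (inj₁ refl) (conn _ 0F)
  ...   | inj₁ ()
  ...   | inj₂ ()

  attachment : ∀ j → ∃ λ i → HasLine C (4 ↑ʳ j) (i ↑ˡ 4)
  attachment j = core-neighbour (kind (proj₁ neighbour)) (proj₂ neighbour)
    where
    neighbour = ¬omits⇒line C (¬omits (4 ↑ʳ j))
    core-neighbour : ∀ {q} → Kind q → HasLine C (4 ↑ʳ j) q → ∃ λ i → HasLine C (4 ↑ʳ j) (i ↑ˡ 4)
    core-neighbour (core i) line = i , line
    core-neighbour (leaf k) line = contradiction (trans (sym line) (leaves-nonadjacent j k)) λ ()

  attach : Fin 4 → Fin 4
  attach j = proj₁ (attachment j)

  leaf-core : ∀ j i → edge C (4 ↑ʳ j) (i ↑ˡ 4) ≡ does (attach j ≟ i)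
  leaf-core j i with attach j ≟ i
  ... | yes refl = proj₂ (attachment j)
  ... | no  j↛i with edge C (4 ↑ʳ j) (i ↑ˡ 4) in ji
  ...   | false = refl
  ...   | true  = contradiction (↑ˡ-injective 4 _ _ (valence-one⇒unique-line C (leaf-valence j) (proj₂ (attachment j)) ji)) j↛i

  core-core : ∀ i j → edge C (i ↑ˡ 4) (j ↑ˡ 4) ≡ coreEdge (edge C 0F 2F) (edge C 1F 3F) i j
  core-core 0F 0F = isIrr 0F
  core-core 0F 1F = contains _ _ refl
  core-core 0F 2F = refl
  core-core 0F 3F = contains _ _ refl
  core-core 1F 0F = contains _ _ refl
  core-core 1F 1F = isIrr 1F
  core-core 1F 2F = contains _ _ refl
  core-core 1F 3F = refl
  core-core 2F 0F = isSym 2F 0F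
  core-core 2F 1F = contains _ _ refl
  core-core 2F 2F = isIrr 2F
  core-core 2F 3F = contains _ _ refl
  core-core 3F 0F = contains _ _ refl
  core-core 3F 1F = isSym 3F 1F
  core-core 3F 2F = contains _ _ refl
  core-core 3F 3F = isIrr 3F

  shapeOf : Shape
  shapeOf = shape (tabulate attach) (edge C 0F 2F , edge C 1F 3F)

  leaf-core-shape : ∀ j i → edge C (4 ↑ʳ j) (i ↑ˡ 4) ≡ does (lookup (Shape.attach shapeOf) j ≟ i)
  leaf-core-shape j i = trans (leaf-core j i) (cong (λ a → does (a ≟ i)) (sym (lookup∘tabulate attach j)))

  edge-kind : ∀ {x y} (kx : Kind x) (ky : Kind y) → edge C x y ≡ kindEdge shapeOf kx ky
  edge-kind (core i) (core j) = core-core i j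
  edge-kind (core i) (leaf j) = trans (isSym _ _) (leaf-core-shape j i)
  edge-kind (leaf j) (core i) = leaf-core-shape j i
  edge-kind (leaf j) (leaf k) = leaves-nonadjacent j k

  C≡shapeComplex : C ≡ shapeComplex shapeOf
  C≡shapeComplex = lineSet-ext λ x y → trans (edge-kind (kind x) (kind y)) (sym (edge-tabulate (λ x y → kindEdge shapeOf (kind x) (kind y)) x y))

  ∈-standardComplexes : C ∈ standardComplexes
  ∈-standardComplexes = ∈-filter⁺ coreValencesThree?
    (subst (_∈ map shapeComplex shapes) (sym C≡shapeComplex) (∈-map⁺ shapeComplex (∈-shapes shapeOf)))
    core-valence

Good⇒standard : ∀ {C} → Good 0F 1F 2F 3F C → C ∈ standardComplexes
Good⇒standard {C} ((isSym , isIrr , len) , conn , (¬omits , _) , contains , _ , v₀ , v₁ , v₂ , v₃) =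
  Classification.∈-standardComplexes C isSym isIrr len conn ¬omits contains v₀ v₁ v₂ v₃

Good-resp : ∀ {a b c d a′ b′ c′ d′ C} → a ≡ a′ → b ≡ b′ → c ≡ c′ → d ≡ d′ → Good a b c d C → Good a′ b′ c′ d′ C
Good-resp refl refl refl refl good = good

module Transfer {a b c d} (distinct : Distinct4 a b c d) (π : Permutation′ 8)
  (π0≡a : π ⟨$⟩ʳ 0F ≡ a) (π1≡b : π ⟨$⟩ʳ 1F ≡ b) (π2≡c : π ⟨$⟩ʳ 2F ≡ c) (π3≡d : π ⟨$⟩ʳ 3F ≡ d) where

  open Relabelling using (relabel-inverse; Good-relabel)

  transport : LineSet → LineSet
  transport = relabel (π ⟨$⟩ˡ_)

  transport-injective : ∀ {C D} → transport C ≡ transport D → C ≡ D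
  transport-injective {C} {D} eq = trans (sym (relabel-inverse π C)) (trans (cong (relabel (π ⟨$⟩ʳ_)) eq) (relabel-inverse π D))

  preimage : ∀ {x i} → π ⟨$⟩ʳ i ≡ x → i ≡ π ⟨$⟩ˡ x
  preimage refl = sym (inverseˡ π)

  transported-good : ∀ C → C ∈ map transport standardComplexes → Good a b c d C
  transported-good C C∈ = good (∈-map⁻ transport C∈)
    where
    good : ∃ (λ D → D ∈ standardComplexes × C ≡ transport D) → Good a b c d C
    good (D , D∈ , refl) = Good-relabel (flip π) D distinct
      (Good-resp (preimage π0≡a) (preimage π1≡b) (preimage π2≡c) (preimage π3≡d)
        (All.lookup standardComplexes-good D∈))

  good⇒transported : ∀ C → Good a b c d C → C ∈ map transport standardComplexes
  good⇒transported C good = subst (_∈ map transport standardComplexes) (relabel-inverse (flip π) C)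
    (∈-map⁺ transport (Good⇒standard (Good-relabel π C distinct0123 (Good-resp (sym π0≡a) (sym π1≡b) (sym π2≡c) (sym π3≡d) good))))

mainTheorem20 : (a b c d : Point) → Distinct4 a b c d →
    Σ (List LineSet) λ L → Unique L × length L ≡ 4 ! ×
    ((C : LineSet) → C ∈ L → Good a b c d C) ×
    ((C : LineSet) → Good a b c d C → C ∈ L)
mainTheorem20 a b c d distinct =
  let π , π0≡a , π1≡b , π2≡c , π3≡d = extend-distinct4 distinct
      open Transfer distinct π π0≡a π1≡b π2≡c π3≡d
  in map transport standardComplexes ,
     Unique.map⁺ transport-injective standardComplexes-unique ,
     trans (length-map transport standardComplexes) standardComplexes-length ,
     transported-good , good⇒transported
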